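{- Let $n\ge3$ be odd and let $$W_n=\Big\{\lambda_i+\lambda_{n+1-i}: i\in\{1,\dots,\lfloor\tfrac{n+1}{4}\rfloor\}\Big\}.$$ Let $\gamma=\frac12\sum_{i=1}^n\min(i,n+1-i)\,\alpha_i$ and $\psi=2\rho-\gamma$. Then every $\mu\in W_n$ satisfies $\frac{n+1}{2}\in I(\mu)\cap I'(\mu)$, where $$I(\mu)=\Big\{i:\tfrac{\mu(\tilde\beta_i)}{2\rho(\tilde\beta_i)}=\min_{1\le j\le n}\tfrac{\mu(\tilde\beta_j)}{2\rho(\tilde\beta_j)}\Big\},\qquad I'(\mu)=\Big\{i:\tfrac{\mu(\tilde\beta_i)}{\psi(\tilde\beta_i)}=\min_{1\le j\le n}\tfrac{\mu(\tilde\beta_j)}{\psi(\tilde\beta_j)}\Big\}.$$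
   Context: $\mathfrak a$ is the space of real traceless diagonal $(n+1)\times(n+1)$ matrices $H=\mathrm{diag}(h_1,\dots,h_{n+1})$ (the Cartan subalgebra of $\mathfrak{sl}(n+1,\mathbb{R})$); simple roots $\alpha_i(H)=h_i-h_{i+1}$; $\tilde\beta_1,\dots,\tilde\beta_n\in\mathfrak a$ with $\alpha_i(\tilde\beta_j)=\delta_{ij}$; fundamental weights $\lambda_i(H)=h_1+\dots+h_i$; $\rho=\sum_i\lambda_i$ is half the sum of positive roots. The functional $\gamma$ equals Oh's functional ($n$ odd): $\frac12(\sum_{i=1}^{(n-1)/2}i\alpha_i+\sum_{i=(n+1)/2}^n(n+1-i)\alpha_i)$. -}

module Defs where

open import Data.Nat as ℕ using (ℕ; zero; suc)
open import Data.Integer using (+_)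
open import Data.Rational as ℚ using (ℚ; 0ℚ; 1ℚ; ½; _+_; _-_; _*_; _⊓_; _÷_; _/_)
open import Data.Rational.Properties using (_≟_)
open import Relation.Nullary using (yes; no)
open import Relation.Binary.PropositionalEquality using (_≡_)

-- An element H = diag(h_1,…,h_{n+1}) of 𝔞 is represented by the function
-- h : ℕ → ℚ, of which only the values h 1, …, h (n+1) are used.
Vect : Set
Vect = ℕ → ℚ

Functional : Set
Functional = Vect → ℚ

sumTo : ℕ → (ℕ → ℚ) → ℚ
sumTo zero    f = 0ℚ
sumTo (suc m) f = sumTo m f + f (suc m)

Traceless : ℕ → Vect → Set
Traceless n h = sumTo (suc n) h ≡ 0ℚ

nℚ : ℕ → ℚ
nℚ k = (+ k) / 1

δ : ℕ → ℕ → ℚ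
δ i j with i ℕ.≟ j
... | yes _ = 1ℚ
... | no  _ = 0ℚ

α : ℕ → Functional
α i h = h i - h (suc i)

λw : ℕ → Functional
λw i h = sumTo i h

_⊕_ : Functional → Functional → Functional
(f ⊕ g) h = f h + g h

ρ : ℕ → Functional
ρ n h = sumTo n (λ i → λw i h)

γ : ℕ → Functional
γ n h = ½ * sumTo n (λ i → nℚ (i ℕ.⊓ (suc n ℕ.∸ i)) * α i h)

ψ : ℕ → Functional
ψ n h = nℚ 2 * ρ n h - γ n h

twoρ : ℕ → Functional
twoρ n h = nℚ 2 * ρ n h

-- division of rationals, total (x/0 := 0); only used with nonzero denominators
div : ℚ → ℚ → ℚ
div p q with q ≟ 0ℚ
... | yes _  = 0ℚ
... | no q≢0 = _÷_ p q {{ℚ.≢-nonZero q≢0}}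

-- min_{1 ≤ j ≤ m} f j   (for m ≥ 1; the value at m = 0 is junk)
minTo : ℕ → (ℕ → ℚ) → ℚ
minTo zero          f = 0ℚ
minTo (suc zero)    f = f 1
minTo (suc (suc m)) f = minTo (suc m) f ⊓ f (suc (suc m))

InMinSet : ℕ → (ℕ → Vect) → Functional → Functional → ℕ → Set
InMinSet n β̃ den μ i =
  div (μ (β̃ i)) (den (β̃ i)) ≡ minTo n (λ j → div (μ (β̃ j)) (den (β̃ j)))

InI : ℕ → (ℕ → Vect) → Functional → ℕ → Set
InI n β̃ μ i = InMinSet n β̃ (twoρ n) μ i

InI' : ℕ → (ℕ → Vect) → Functional → ℕ → Set
InI' n β̃ μ i = InMinSet n β̃ (ψ n) μ i

-- Writing N = n + 1 = 2m, the fundamental coweight β̃_j has coordinates h_k = c for k ≤ j and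
-- h_k = c − 1 for k > j, where N c = N − j.  Hence λ_k(β̃_j) = k c − (k − j)⁺ and, with
-- a = min(j, N − j), one finds μ(β̃_j) = min(i, a), 2ρ(β̃_j) = j (N − j) = a (2m − a) and
-- γ(β̃_j) = a / 2.  Both ratios therefore depend on a only.  For a ≥ i the numerator is i and
-- the denominator grows with a, so a = m is best; for a < i the ratio μ/2ρ is 1 / (2m − a) ≥ 1 / 2m,
-- which is at least i / m² exactly because 2i ≤ m, i.e. i ≤ (n + 1)/4 (similarly for ψ).
-- So j = m = (n + 1)/2 attains both minima.
module Submission where

open import Defs
open import Data.Nat as ℕ
  using (ℕ; zero; suc; _+_; _*_; _∸_; _≤_; _<_; _⊓_; _%_; _/_; s≤s; z≤n)
import Data.Nat.Properties as ℕP
open import Data.Nat.DivMod using (m≡m%n+[m/n]*n; m*n/n≡m; m/n*n≤m)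
open import Data.Nat.Tactic.RingSolver using (solve-∀)
import Data.Integer as ℤ
import Data.Integer.Properties as ℤP
import Data.Integer.Tactic.RingSolver as ℤ-Solver
open import Data.Rational as ℚ using (ℚ; 0ℚ; 1ℚ; ½)
import Data.Rational.Properties as ℚP
open import Data.Rational.Solver using (module +-*-Solver)
import Data.Rational.Unnormalised as ℚᵘ
import Data.Rational.Unnormalised.Properties as ℚᵘP
open import Algebra.Properties.CommutativeSemigroup ℕP.*-commutativeSemigroup
  using (x∙yz≈y∙xz)
open import Data.Empty using (⊥-elim)
open import Data.Product using (Σ; _×_; _,_)
open import Data.Sum using (inj₁; inj₂; [_,_]′)
open import Relation.Binary.PropositionalEquality
open import Relation.Nullary using (yes; no; ¬_)

open +-*-Solver

toℚᵘ-nℚ : ∀ k → ℚ.toℚᵘ (nℚ k) ℚᵘ.≃ ℚᵘ.mkℚᵘ (ℤ.+ k) 0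
toℚᵘ-nℚ k = ℚP.toℚᵘ-fromℚᵘ (ℚᵘ.mkℚᵘ (ℤ.+ k) 0)

nℚ-+ : ∀ a b → nℚ (a + b) ≡ nℚ a ℚ.+ nℚ b
nℚ-+ a b = ℚP.toℚᵘ-injective (begin
  ℚ.toℚᵘ (nℚ (a + b))
    ≈⟨ toℚᵘ-nℚ (a + b) ⟩
  ℚᵘ.mkℚᵘ (ℤ.+ (a + b)) 0
    ≈⟨ ℚᵘ.*≡* (trans (cong (ℤ._* ℤ.1ℤ) (ℤP.pos-+ a b)) (identity (ℤ.+ a) (ℤ.+ b))) ⟩
  ℚᵘ.mkℚᵘ (ℤ.+ a) 0 ℚᵘ.+ ℚᵘ.mkℚᵘ (ℤ.+ b) 0
    ≈⟨ ℚᵘP.+-cong (ℚᵘP.≃-sym (toℚᵘ-nℚ a)) (ℚᵘP.≃-sym (toℚᵘ-nℚ b)) ⟩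
  ℚ.toℚᵘ (nℚ a) ℚᵘ.+ ℚ.toℚᵘ (nℚ b)
    ≈⟨ ℚᵘP.≃-sym (ℚP.toℚᵘ-homo-+ (nℚ a) (nℚ b)) ⟩
  ℚ.toℚᵘ (nℚ a ℚ.+ nℚ b)
    ∎)
  where
  open import Relation.Binary.Reasoning.Setoid ℚᵘP.≃-setoid
  identity : ∀ x y → (x ℤ.+ y) ℤ.* ℤ.1ℤ ≡ (x ℤ.* ℤ.1ℤ ℤ.+ y ℤ.* ℤ.1ℤ) ℤ.* (ℤ.1ℤ ℤ.* ℤ.1ℤ)
  identity = ℤ-Solver.solve-∀

nℚ-* : ∀ a b → nℚ (a * b) ≡ nℚ a ℚ.* nℚ b
nℚ-* a b = ℚP.toℚᵘ-injective (begin
  ℚ.toℚᵘ (nℚ (a * b))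
    ≈⟨ toℚᵘ-nℚ (a * b) ⟩
  ℚᵘ.mkℚᵘ (ℤ.+ (a * b)) 0
    ≈⟨ ℚᵘ.*≡* (trans (cong (ℤ._* ℤ.1ℤ) (ℤP.pos-* a b)) (identity (ℤ.+ a) (ℤ.+ b))) ⟩
  ℚᵘ.mkℚᵘ (ℤ.+ a) 0 ℚᵘ.* ℚᵘ.mkℚᵘ (ℤ.+ b) 0
    ≈⟨ ℚᵘP.*-cong (ℚᵘP.≃-sym (toℚᵘ-nℚ a)) (ℚᵘP.≃-sym (toℚᵘ-nℚ b)) ⟩
  ℚ.toℚᵘ (nℚ a) ℚᵘ.* ℚ.toℚᵘ (nℚ b)
    ≈⟨ ℚᵘP.≃-sym (ℚP.toℚᵘ-homo-* (nℚ a) (nℚ b)) ⟩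
  ℚ.toℚᵘ (nℚ a ℚ.* nℚ b)
    ∎)
  where
  open import Relation.Binary.Reasoning.Setoid ℚᵘP.≃-setoid
  identity : ∀ x y → (x ℤ.* y) ℤ.* ℤ.1ℤ ≡ (x ℤ.* y) ℤ.* (ℤ.1ℤ ℤ.* ℤ.1ℤ)
  identity = ℤ-Solver.solve-∀

nℚ-suc : ∀ k → nℚ (suc k) ≡ 1ℚ ℚ.+ nℚ k
nℚ-suc = nℚ-+ 1

nℚ-mono-≤ : ∀ {a b} → a ≤ b → nℚ a ℚ.≤ nℚ b
nℚ-mono-≤ {a} {b} a≤b = ℚP.toℚᵘ-cancel-≤
  (ℚᵘP.≤-respˡ-≃ (ℚᵘP.≃-sym (toℚᵘ-nℚ a)) (ℚᵘP.≤-respʳ-≃ (ℚᵘP.≃-sym (toℚᵘ-nℚ b))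
    (ℚᵘ.*≤* (ℤP.*-monoʳ-≤-nonNeg ℤ.1ℤ (ℤ.+≤+ a≤b)))))

nℚ-positive : ∀ {k} → 1 ≤ k → ℚ.Positive (nℚ k)
nℚ-positive 1≤k = ℚ.positive (ℚP.<-≤-trans (ℚP.positive⁻¹ 1ℚ) (nℚ-mono-≤ 1≤k))

nℚ-+-cancelʳ : ∀ x y → nℚ (x + y) ℚ.- nℚ y ≡ nℚ x
nℚ-+-cancelʳ x y = trans (cong (ℚ._- nℚ y) (nℚ-+ x y))
  (solve 2 (λ x y → (x :+ y) :- y := x) refl (nℚ x) (nℚ y))

half-difference : ∀ {x y z} → x + y ≡ 2 * z → nℚ z ℚ.- ½ ℚ.* nℚ y ≡ ½ ℚ.* nℚ x
half-difference {x} {y} {z} x+y≡2z = begin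
  nℚ z ℚ.- ½ ℚ.* nℚ y
    ≡⟨ solve 2 (λ z y → z :- con ½ :* y := con ½ :* (con (nℚ 2) :* z) :- con ½ :* y)
         refl (nℚ z) (nℚ y) ⟩
  ½ ℚ.* (nℚ 2 ℚ.* nℚ z) ℚ.- ½ ℚ.* nℚ y
    ≡⟨ cong (λ w → ½ ℚ.* w ℚ.- ½ ℚ.* nℚ y) (trans (sym (nℚ-* 2 z)) (cong nℚ (sym x+y≡2z))) ⟩
  ½ ℚ.* nℚ (x + y) ℚ.- ½ ℚ.* nℚ y
    ≡⟨ cong (λ w → ½ ℚ.* w ℚ.- ½ ℚ.* nℚ y) (nℚ-+ x y) ⟩
  ½ ℚ.* (nℚ x ℚ.+ nℚ y) ℚ.- ½ ℚ.* nℚ y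
    ≡⟨ solve 2 (λ x y → con ½ :* (x :+ y) :- con ½ :* y := con ½ :* x) refl (nℚ x) (nℚ y) ⟩
  ½ ℚ.* nℚ x
    ∎
  where open ≡-Reasoning

div-*-cancel : ∀ p q .{{_ : ℚ.Positive q}} → div p q ℚ.* q ≡ p
div-*-cancel p q with q ℚP.≟ 0ℚ
... | yes q≡0 = ⊥-elim (ℚP.<-irrefl (sym q≡0) (ℚP.positive⁻¹ q))
... | no  q≢0 = trans (ℚP.*-assoc p _ q)
  (trans (cong (p ℚ.*_) (ℚP.*-inverseˡ q {{ℚ.≢-nonZero q≢0}})) (ℚP.*-identityʳ p))

div-mono-cross : ∀ p q r s .{{_ : ℚ.Positive q}} .{{_ : ℚ.Positive s}} →
                 p ℚ.* s ℚ.≤ r ℚ.* q → div p q ℚ.≤ div r s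
div-mono-cross p q r s ps≤rq = ℚP.*-cancelʳ-≤-pos (q ℚ.* s) {{ℚP.pos*pos⇒pos q s}}
  (subst₂ ℚ._≤_ (sym lhs) (sym rhs) ps≤rq)
  where
  open ≡-Reasoning
  lhs : div p q ℚ.* (q ℚ.* s) ≡ p ℚ.* s
  lhs = begin
    div p q ℚ.* (q ℚ.* s)  ≡⟨ ℚP.*-assoc (div p q) q s ⟨
    div p q ℚ.* q ℚ.* s    ≡⟨ cong (ℚ._* s) (div-*-cancel p q) ⟩
    p ℚ.* s                ∎
  rhs : div r s ℚ.* (q ℚ.* s) ≡ r ℚ.* q
  rhs = begin
    div r s ℚ.* (q ℚ.* s)  ≡⟨ cong (div r s ℚ.*_) (ℚP.*-comm q s) ⟩
    div r s ℚ.* (s ℚ.* q)  ≡⟨ ℚP.*-assoc (div r s) s q ⟨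
    div r s ℚ.* s ℚ.* q    ≡⟨ cong (ℚ._* q) (div-*-cancel r s) ⟩
    r ℚ.* q                ∎

nℚ-ratio-≤ : ∀ κ .{{_ : ℚ.Positive κ}} p q r s → 1 ≤ q → 1 ≤ s → p * s ≤ r * q →
             div (nℚ p) (κ ℚ.* nℚ q) ℚ.≤ div (nℚ r) (κ ℚ.* nℚ s)
nℚ-ratio-≤ κ p q r s 1≤q 1≤s ps≤rq =
  div-mono-cross (nℚ p) (κ ℚ.* nℚ q) (nℚ r) (κ ℚ.* nℚ s)
    {{ℚP.pos*pos⇒pos κ (nℚ q) {{nℚ-positive 1≤q}}}} {{ℚP.pos*pos⇒pos κ (nℚ s) {{nℚ-positive 1≤s}}}}
    (subst₂ ℚ._≤_ (scale (nℚ p) (nℚ s)) (scale (nℚ r) (nℚ q))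
      (ℚP.*-monoˡ-≤-nonNeg κ {{ℚP.pos⇒nonNeg κ}}
        (subst₂ ℚ._≤_ (nℚ-* p s) (nℚ-* r q) (nℚ-mono-≤ ps≤rq))))
  where
  scale : ∀ x y → κ ℚ.* (x ℚ.* y) ≡ x ℚ.* (κ ℚ.* y)
  scale = solve 3 (λ k x y → k :* (x :* y) := x :* (k :* y)) refl κ

minTo-glb : ∀ n f x → 1 ≤ n → (∀ j → 1 ≤ j → j ≤ n → x ℚ.≤ f j) → x ℚ.≤ minTo n f
minTo-glb (suc zero)    f x _ x≤f = x≤f 1 ℕP.≤-refl ℕP.≤-refl
minTo-glb (suc (suc n)) f x _ x≤f = ℚP.⊓-glb
  (minTo-glb (suc n) f x (s≤s z≤n) λ j 1≤j j≤1+n → x≤f j 1≤j (ℕP.m≤n⇒m≤1+n j≤1+n))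
  (x≤f (suc (suc n)) (s≤s z≤n) ℕP.≤-refl)

minTo-suc-attained : ∀ n f k → 1 ≤ k → k ≤ suc n →
                     (∀ j → 1 ≤ j → j ≤ suc n → f k ℚ.≤ f j) → minTo (suc n) f ≡ f k
minTo-suc-attained zero    f (suc zero)    _   _        _   = refl
minTo-suc-attained zero    f (suc (suc k)) _   (s≤s ()) _
minTo-suc-attained (suc n) f k             1≤k k≤2+n    fk≤ =
  [ below , last ]′ (ℕP.m≤n⇒m<n∨m≡n k≤2+n)
  where
  fk≤-init : ∀ j → 1 ≤ j → j ≤ suc n → f k ℚ.≤ f j
  fk≤-init j 1≤j j≤1+n = fk≤ j 1≤j (ℕP.m≤n⇒m≤1+n j≤1+n)
  below : k < suc (suc n) → minTo (suc (suc n)) f ≡ f k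
  below (s≤s k≤1+n) = trans
    (cong (ℚ._⊓ f (suc (suc n))) (minTo-suc-attained n f k 1≤k k≤1+n fk≤-init))
    (ℚP.p≤q⇒p⊓q≡p (fk≤ (suc (suc n)) (s≤s z≤n) ℕP.≤-refl))
  last : k ≡ suc (suc n) → minTo (suc (suc n)) f ≡ f k
  last refl = ℚP.p≥q⇒p⊓q≡q (minTo-glb (suc n) f (f k) (s≤s z≤n) fk≤-init)

minTo-attained : ∀ n f k → 1 ≤ k → k ≤ n →
                 (∀ j → 1 ≤ j → j ≤ n → f k ℚ.≤ f j) → minTo n f ≡ f k
minTo-attained zero    f k 1≤k k≤0 _ = ⊥-elim (ℕP.<⇒≱ 1≤k k≤0)
minTo-attained (suc n) = minTo-suc-attained n

m+o≡n⇒m≤n : ∀ {m n} o → m + o ≡ n → m ≤ n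
m+o≡n⇒m≤n {m} o refl = ℕP.m≤m+n m o

∸-∸-comm : ∀ m n o → (m ∸ n) ∸ o ≡ (m ∸ o) ∸ n
∸-∸-comm m n o = begin
  (m ∸ n) ∸ o  ≡⟨ ℕP.∸-+-assoc m n o ⟩
  m ∸ (n + o)  ≡⟨ cong (m ∸_) (ℕP.+-comm n o) ⟩
  m ∸ (o + n)  ≡⟨ ℕP.∸-+-assoc m o n ⟨
  (m ∸ o) ∸ n  ∎
  where open ≡-Reasoning

+-∸-∸ : ∀ {N} i j → i + j ≤ N → i + ((N ∸ i) ∸ j) ≡ N ∸ j
+-∸-∸ {N} i j i+j≤N =
  trans (cong (i +_) (∸-∸-comm N i j)) (ℕP.m+[n∸m]≡n (ℕP.m+n≤o⇒m≤o∸n i i+j≤N))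

⊓-+-overshoots : ∀ N i j → i + i ≤ N →
                 i ⊓ (j ⊓ (N ∸ j)) + ((i ∸ j) + ((N ∸ i) ∸ j)) ≡ N ∸ j
⊓-+-overshoots N i j 2i≤N with ℕP.≤-total j i | i + j ℕP.≤? N
... | inj₁ j≤i | _ = begin
  i ⊓ (j ⊓ (N ∸ j)) + ((i ∸ j) + ((N ∸ i) ∸ j))  ≡⟨ cong (_+ ((i ∸ j) + ((N ∸ i) ∸ j))) i⊓a≡j ⟩
  j + ((i ∸ j) + ((N ∸ i) ∸ j))                  ≡⟨ ℕP.+-assoc j (i ∸ j) ((N ∸ i) ∸ j) ⟨
  j + (i ∸ j) + ((N ∸ i) ∸ j)                    ≡⟨ cong (_+ ((N ∸ i) ∸ j)) (ℕP.m+[n∸m]≡n j≤i) ⟩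
  i + ((N ∸ i) ∸ j)                              ≡⟨ +-∸-∸ i j i+j≤N ⟩
  N ∸ j                                          ∎
  where
  open ≡-Reasoning
  i+j≤N : i + j ≤ N
  i+j≤N = ℕP.≤-trans (ℕP.+-monoʳ-≤ i j≤i) 2i≤N
  j≤N∸j : j ≤ N ∸ j
  j≤N∸j = ℕP.m+n≤o⇒m≤o∸n j (ℕP.≤-trans (ℕP.+-monoˡ-≤ j j≤i) i+j≤N)
  i⊓a≡j : i ⊓ (j ⊓ (N ∸ j)) ≡ j
  i⊓a≡j = trans (cong (i ⊓_) (ℕP.m≤n⇒m⊓n≡m j≤N∸j)) (ℕP.m≥n⇒m⊓n≡n j≤i)
... | inj₂ i≤j | yes i+j≤N = begin
  i ⊓ (j ⊓ (N ∸ j)) + ((i ∸ j) + ((N ∸ i) ∸ j))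
    ≡⟨ cong₂ (λ a b → a + (b + ((N ∸ i) ∸ j))) i⊓a≡i (ℕP.m≤n⇒m∸n≡0 i≤j) ⟩
  i + ((N ∸ i) ∸ j)
    ≡⟨ +-∸-∸ i j i+j≤N ⟩
  N ∸ j
    ∎
  where
  open ≡-Reasoning
  i⊓a≡i : i ⊓ (j ⊓ (N ∸ j)) ≡ i
  i⊓a≡i = ℕP.m≤n⇒m⊓n≡m (ℕP.⊓-glb i≤j (ℕP.m+n≤o⇒m≤o∸n i i+j≤N))
... | inj₂ i≤j | no i+j≰N = begin
  i ⊓ (j ⊓ (N ∸ j)) + ((i ∸ j) + ((N ∸ i) ∸ j))
    ≡⟨ cong₂ (λ a b → a + (b + ((N ∸ i) ∸ j))) i⊓a≡N∸j (ℕP.m≤n⇒m∸n≡0 i≤j) ⟩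
  (N ∸ j) + ((N ∸ i) ∸ j)
    ≡⟨ cong ((N ∸ j) +_) (ℕP.m≤n⇒m∸n≡0 (ℕP.m≤n+o⇒m∸n≤o N i N≤i+j)) ⟩
  (N ∸ j) + 0
    ≡⟨ ℕP.+-identityʳ (N ∸ j) ⟩
  N ∸ j
    ∎
  where
  open ≡-Reasoning
  N≤i+j : N ≤ i + j
  N≤i+j = ℕP.<⇒≤ (ℕP.≰⇒> i+j≰N)
  N∸j≤i : N ∸ j ≤ i
  N∸j≤i = ℕP.m≤n+o⇒m∸n≤o N j (subst (N ≤_) (ℕP.+-comm i j) N≤i+j)
  i⊓a≡N∸j : i ⊓ (j ⊓ (N ∸ j)) ≡ N ∸ j
  i⊓a≡N∸j = trans (cong (i ⊓_) (ℕP.m≥n⇒m⊓n≡n (ℕP.≤-trans N∸j≤i i≤j))) (ℕP.m≥n⇒m⊓n≡n N∸j≤i)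

∸-pronic-step : ∀ r j → (r ∸ j) * (suc r ∸ j) + 2 * (suc r ∸ j) ≡ (suc r ∸ j) * (suc (suc r) ∸ j)
∸-pronic-step r       zero    = pronic-step r
  where
  pronic-step : ∀ r → r * suc r + 2 * suc r ≡ suc r * suc (suc r)
  pronic-step = solve-∀
∸-pronic-step zero    (suc j) rewrite ℕP.0∸n≡0 j = refl
∸-pronic-step (suc r) (suc j) = ∸-pronic-step r j

⊓-∸-≤-half : ∀ m j → j ⊓ (m + m ∸ j) ≤ m
⊓-∸-≤-half m j with ℕP.≤-total j m
... | inj₁ j≤m = ℕP.≤-trans (ℕP.m⊓n≤m j (m + m ∸ j)) j≤m
... | inj₂ m≤j = ℕP.≤-trans (ℕP.m⊓n≤n j (m + m ∸ j))
                            (ℕP.m≤n+o⇒m∸n≤o (m + m) j (ℕP.+-monoˡ-≤ m m≤j))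

*-∸-⊓ : ∀ {N} j → j ≤ N → j * (N ∸ j) ≡ (j ⊓ (N ∸ j)) * (N ∸ (j ⊓ (N ∸ j)))
*-∸-⊓ {N} j j≤N with ℕP.≤-total j (N ∸ j)
... | inj₁ j≤N∸j rewrite ℕP.m≤n⇒m⊓n≡m j≤N∸j = refl
... | inj₂ N∸j≤j rewrite ℕP.m≥n⇒m⊓n≡n N∸j≤j | ℕP.m∸[m∸n]≡n j≤N = ℕP.*-comm j (N ∸ j)

∸-around-half : ∀ {a m} → a ≤ m → m + m ∸ a ≡ a + ((m ∸ a) + (m ∸ a))
∸-around-half {a} a≤m with ℕP.m≤n⇒∃[o]m+o≡n a≤m
... | d , refl rewrite ℕP.m+n∸m≡n a d =
  trans (cong (_∸ a) (regroup a d)) (ℕP.m+n∸m≡n a (a + (d + d)))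
  where
  regroup : ∀ a d → a + d + (a + d) ≡ a + (a + (d + d))
  regroup = solve-∀

odd-halves : ∀ {n} → n % 2 ≡ 1 → suc n ≡ suc n / 2 + suc n / 2
odd-halves {n} n-odd = begin
  suc n                  ≡⟨ 1+n≡[1+q]*2 ⟩
  suc q * 2              ≡⟨ doubling (suc q) ⟩
  suc q + suc q          ≡⟨ cong₂ _+_ half half ⟨
  suc n / 2 + suc n / 2  ∎
  where
  open ≡-Reasoning
  q = n / 2
  1+n≡[1+q]*2 : suc n ≡ suc q * 2
  1+n≡[1+q]*2 = cong suc (trans (m≡m%n+[m/n]*n n 2) (cong (_+ q * 2) n-odd))
  half : suc n / 2 ≡ suc q
  half = trans (cong (_/ 2) 1+n≡[1+q]*2) (m*n/n≡m (suc q) 2)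
  doubling : ∀ x → x * 2 ≡ x + x
  doubling = solve-∀

quarter-doubled-≤-half : ∀ {N m i} → N ≡ m + m → i ≤ N / 4 → i + i ≤ m
quarter-doubled-≤-half {N} {m} {i} N≡2m i≤N/4 = ℕP.*-cancelʳ-≤ (i + i) m 2 (begin
  (i + i) * 2  ≡⟨ quadruple i ⟩
  i * 4        ≤⟨ ℕP.*-monoˡ-≤ 4 i≤N/4 ⟩
  N / 4 * 4    ≤⟨ m/n*n≤m N 4 ⟩
  N            ≡⟨ N≡2m ⟩
  m + m        ≡⟨ doubling m ⟨
  m * 2        ∎)
  where
  open ℕP.≤-Reasoning
  quadruple : ∀ x → (x + x) * 2 ≡ x * 4
  quadruple = solve-∀
  doubling : ∀ x → x * 2 ≡ x + x
  doubling = solve-∀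

δ-diag : ∀ k → δ k k ≡ 1ℚ
δ-diag k with k ℕ.≟ k
... | yes _   = refl
... | no  k≢k = ⊥-elim (k≢k refl)

δ-offdiag : ∀ {k j} → ¬ k ≡ j → δ k j ≡ 0ℚ
δ-offdiag {k} {j} k≢j with k ℕ.≟ j
... | yes k≡j = ⊥-elim (k≢j k≡j)
... | no  _   = refl

module Coweight (n j : ℕ) (1≤j : 1 ≤ j) (j≤n : j ≤ n) (h : Vect)
                (traceless : Traceless n h) (dual : ∀ k → 1 ≤ k → k ≤ n → α k h ≡ δ k j) where

  h₁ : ℚ
  h₁ = h 1

  h-step : ∀ k → 1 ≤ k → k ≤ n → h (suc k) ≡ h k ℚ.- δ k j
  h-step k 1≤k k≤n = trans (shift (h k) (h (suc k))) (cong (ℚ._-_ (h k)) (dual k 1≤k k≤n))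
    where
    shift : ∀ x y → y ≡ x ℚ.- (x ℚ.- y)
    shift = solve 2 (λ x y → y := x :- (x :- y)) refl

  h-step-offdiag : ∀ k → 1 ≤ k → k ≤ n → ¬ k ≡ j → h (suc k) ≡ h k
  h-step-offdiag k 1≤k k≤n k≢j = trans (h-step k 1≤k k≤n)
    (trans (cong (ℚ._-_ (h k)) (δ-offdiag k≢j)) (solve 1 (λ x → x :- con 0ℚ := x) refl (h k)))

  h-below : ∀ k → 1 ≤ k → k ≤ j → h k ≡ h₁
  h-below (suc zero)    _ _     = refl
  h-below (suc (suc k)) _ 2+k≤j = trans
    (h-step-offdiag (suc k) (s≤s z≤n) (ℕP.≤-trans (ℕP.<⇒≤ 2+k≤j) j≤n) (ℕP.<⇒≢ 2+k≤j))
    (h-below (suc k) (s≤s z≤n) (ℕP.<⇒≤ 2+k≤j))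

  h-above : ∀ k → j < k → k ≤ suc n → h k ≡ h₁ ℚ.- 1ℚ
  h-above (suc k) (s≤s j≤k) 1+k≤1+n with ℕP.m≤n⇒m<n∨m≡n j≤k
  ... | inj₁ j<k = trans (h-step-offdiag k (ℕP.≤-trans 1≤j j≤k) k≤n (ℕP.>⇒≢ j<k))
                         (h-above k j<k (ℕP.m≤n⇒m≤1+n k≤n))
    where k≤n = ℕ.s≤s⁻¹ 1+k≤1+n
  ... | inj₂ refl = trans (h-step j 1≤j j≤n) (cong₂ ℚ._-_ (h-below j 1≤j ℕP.≤-refl) (δ-diag j))

  h-jump : ∀ k → k ≤ n → Σ ℕ λ t → h (suc k) ≡ h₁ ℚ.- nℚ t × suc k ∸ j ≡ t + (k ∸ j)
  h-jump k k≤n with suc k ℕP.≤? j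
  ... | yes 1+k≤j = 0 ,
    trans (h-below (suc k) (s≤s z≤n) 1+k≤j) (solve 1 (λ x → x := x :- con 0ℚ) refl h₁) ,
    trans (ℕP.m≤n⇒m∸n≡0 1+k≤j) (sym (ℕP.m≤n⇒m∸n≡0 (ℕP.<⇒≤ 1+k≤j)))
  ... | no  1+k≰j = 1 ,
    h-above (suc k) (ℕP.≰⇒> 1+k≰j) (s≤s k≤n) ,
    ℕP.+-∸-assoc 1 (ℕ.s≤s⁻¹ (ℕP.≰⇒> 1+k≰j))

  λw-coweight : ∀ k → k ≤ suc n → λw k h ≡ nℚ k ℚ.* h₁ ℚ.- nℚ (k ∸ j)
  λw-coweight zero    _ rewrite ℕP.0∸n≡0 j =
    solve 1 (λ c → con 0ℚ := con 0ℚ :* c :- con 0ℚ) refl h₁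
  λw-coweight (suc k) (s≤s k≤n) with h-jump k k≤n
  ... | t , h[1+k] , [1+k]∸j = begin
    sumTo k h ℚ.+ h (suc k)
      ≡⟨ cong₂ ℚ._+_ (λw-coweight k (ℕP.m≤n⇒m≤1+n k≤n)) h[1+k] ⟩
    (nℚ k ℚ.* h₁ ℚ.- nℚ (k ∸ j)) ℚ.+ (h₁ ℚ.- nℚ t)
      ≡⟨ solve 4 (λ K c x t → (K :* c :- x) :+ (c :- t) := (con 1ℚ :+ K) :* c :- (t :+ x))
           refl (nℚ k) h₁ (nℚ (k ∸ j)) (nℚ t) ⟩
    (1ℚ ℚ.+ nℚ k) ℚ.* h₁ ℚ.- (nℚ t ℚ.+ nℚ (k ∸ j))
      ≡⟨ cong₂ (λ a b → a ℚ.* h₁ ℚ.- b) (sym (nℚ-suc k))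
                                        (trans (sym (nℚ-+ t (k ∸ j))) (cong nℚ (sym [1+k]∸j))) ⟩
    nℚ (suc k) ℚ.* h₁ ℚ.- nℚ (suc k ∸ j)
      ∎
    where open ≡-Reasoning

  [1+n]*h₁≡1+n∸j : nℚ (suc n) ℚ.* h₁ ≡ nℚ (suc n ∸ j)
  [1+n]*h₁≡1+n∸j = begin
    nℚ (suc n) ℚ.* h₁
      ≡⟨ solve 2 (λ x y → x := (x :- y) :+ y) refl (nℚ (suc n) ℚ.* h₁) (nℚ (suc n ∸ j)) ⟩
    (nℚ (suc n) ℚ.* h₁ ℚ.- nℚ (suc n ∸ j)) ℚ.+ nℚ (suc n ∸ j)
      ≡⟨ cong (ℚ._+ nℚ (suc n ∸ j)) (trans (sym (λw-coweight (suc n) ℕP.≤-refl)) traceless) ⟩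
    0ℚ ℚ.+ nℚ (suc n ∸ j)
      ≡⟨ ℚP.+-identityˡ (nℚ (suc n ∸ j)) ⟩
    nℚ (suc n ∸ j)
      ∎
    where open ≡-Reasoning

  μ-coweight : ∀ i → i + i ≤ suc n → (λw i ⊕ λw (suc n ∸ i)) h ≡ nℚ (i ⊓ (j ⊓ (suc n ∸ j)))
  μ-coweight i 2i≤1+n = begin
    λw i h ℚ.+ λw (suc n ∸ i) h
      ≡⟨ cong₂ ℚ._+_ (λw-coweight i i≤1+n) (λw-coweight (suc n ∸ i) (ℕP.m∸n≤m (suc n) i)) ⟩
    (nℚ i ℚ.* h₁ ℚ.- nℚ (i ∸ j)) ℚ.+ (nℚ (suc n ∸ i) ℚ.* h₁ ℚ.- nℚ ((suc n ∸ i) ∸ j))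
      ≡⟨ solve 5 (λ a b c x y → (a :* c :- x) :+ (b :* c :- y) := (a :+ b) :* c :- (x :+ y))
           refl (nℚ i) (nℚ (suc n ∸ i)) h₁ (nℚ (i ∸ j)) (nℚ ((suc n ∸ i) ∸ j)) ⟩
    (nℚ i ℚ.+ nℚ (suc n ∸ i)) ℚ.* h₁ ℚ.- (nℚ (i ∸ j) ℚ.+ nℚ ((suc n ∸ i) ∸ j))
      ≡⟨ cong₂ (λ a b → a ℚ.* h₁ ℚ.- b)
           (trans (sym (nℚ-+ i (suc n ∸ i))) (cong nℚ (ℕP.m+[n∸m]≡n i≤1+n)))
           (sym (nℚ-+ (i ∸ j) ((suc n ∸ i) ∸ j))) ⟩
    nℚ (suc n) ℚ.* h₁ ℚ.- nℚ overshoot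
      ≡⟨ cong (ℚ._- nℚ overshoot)
           (trans [1+n]*h₁≡1+n∸j (cong nℚ (sym (⊓-+-overshoots (suc n) i j 2i≤1+n)))) ⟩
    nℚ (i ⊓ (j ⊓ (suc n ∸ j)) + overshoot) ℚ.- nℚ overshoot
      ≡⟨ nℚ-+-cancelʳ (i ⊓ (j ⊓ (suc n ∸ j))) overshoot ⟩
    nℚ (i ⊓ (j ⊓ (suc n ∸ j)))
      ∎
    where
    open ≡-Reasoning
    overshoot = (i ∸ j) + ((suc n ∸ i) ∸ j)
    i≤1+n : i ≤ suc n
    i≤1+n = ℕP.m+n≤o⇒m≤o i 2i≤1+n

  twice-Σλw : ∀ r → r ≤ n →
              nℚ 2 ℚ.* sumTo r (λ k → λw k h) ≡ nℚ (r * suc r) ℚ.* h₁ ℚ.- nℚ ((r ∸ j) * (suc r ∸ j))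
  twice-Σλw zero    _ rewrite ℕP.0∸n≡0 j =
    solve 1 (λ c → con (nℚ 2) :* con 0ℚ := con 0ℚ :* c :- con 0ℚ) refl h₁
  twice-Σλw (suc r) 1+r≤n = begin
    nℚ 2 ℚ.* (S ℚ.+ λw (suc r) h)
      ≡⟨ ℚP.*-distribˡ-+ (nℚ 2) S (λw (suc r) h) ⟩
    nℚ 2 ℚ.* S ℚ.+ nℚ 2 ℚ.* λw (suc r) h
      ≡⟨ cong₂ (λ a b → a ℚ.+ nℚ 2 ℚ.* b) (twice-Σλw r (ℕP.<⇒≤ 1+r≤n))
                                          (λw-coweight (suc r) (ℕP.m≤n⇒m≤1+n 1+r≤n)) ⟩
    (nℚ (r * suc r) ℚ.* h₁ ℚ.- nℚ T) ℚ.+ nℚ 2 ℚ.* (nℚ (suc r) ℚ.* h₁ ℚ.- nℚ (suc r ∸ j))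
      ≡⟨ solve 5 (λ A c T R y → (A :* c :- T) :+ two :* (R :* c :- y)
                              := (A :+ two :* R) :* c :- (T :+ two :* y))
           refl (nℚ (r * suc r)) h₁ (nℚ T) (nℚ (suc r)) (nℚ (suc r ∸ j)) ⟩
    (nℚ (r * suc r) ℚ.+ nℚ 2 ℚ.* nℚ (suc r)) ℚ.* h₁ ℚ.- (nℚ T ℚ.+ nℚ 2 ℚ.* nℚ (suc r ∸ j))
      ≡⟨ cong₂ (λ a b → a ℚ.* h₁ ℚ.- b) (embed (r * suc r) (suc r)) (embed T (suc r ∸ j)) ⟩
    nℚ (r * suc r + 2 * suc r) ℚ.* h₁ ℚ.- nℚ (T + 2 * (suc r ∸ j))
      ≡⟨ cong₂ (λ a b → nℚ a ℚ.* h₁ ℚ.- nℚ b) (∸-pronic-step r 0) (∸-pronic-step r j) ⟩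
    nℚ (suc r * suc (suc r)) ℚ.* h₁ ℚ.- nℚ ((suc r ∸ j) * (suc (suc r) ∸ j))
      ∎
    where
    open ≡-Reasoning
    two = con (nℚ 2)
    S = sumTo r (λ k → λw k h)
    T = (r ∸ j) * (suc r ∸ j)
    embed : ∀ x y → nℚ x ℚ.+ nℚ 2 ℚ.* nℚ y ≡ nℚ (x + 2 * y)
    embed x y = sym (trans (nℚ-+ x (2 * y)) (cong (nℚ x ℚ.+_) (nℚ-* 2 y)))

  twoρ-coweight : twoρ n h ≡ nℚ (j * (suc n ∸ j))
  twoρ-coweight = begin
    nℚ 2 ℚ.* ρ n h                     ≡⟨ twice-Σλw n ℕP.≤-refl ⟩
    nℚ (n * suc n) ℚ.* h₁ ℚ.- nℚ T     ≡⟨ cong (ℚ._- nℚ T) n[1+n]h₁ ⟩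
    nℚ (j * (suc n ∸ j) + T) ℚ.- nℚ T  ≡⟨ nℚ-+-cancelʳ (j * (suc n ∸ j)) T ⟩
    nℚ (j * (suc n ∸ j))               ∎
    where
    open ≡-Reasoning
    T = (n ∸ j) * (suc n ∸ j)
    n[1+n]h₁ : nℚ (n * suc n) ℚ.* h₁ ≡ nℚ (j * (suc n ∸ j) + T)
    n[1+n]h₁ = begin
      nℚ (n * suc n) ℚ.* h₁           ≡⟨ cong (ℚ._* h₁) (nℚ-* n (suc n)) ⟩
      nℚ n ℚ.* nℚ (suc n) ℚ.* h₁      ≡⟨ ℚP.*-assoc (nℚ n) (nℚ (suc n)) h₁ ⟩
      nℚ n ℚ.* (nℚ (suc n) ℚ.* h₁)    ≡⟨ cong (nℚ n ℚ.*_) [1+n]*h₁≡1+n∸j ⟩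
      nℚ n ℚ.* nℚ (suc n ∸ j)         ≡⟨ nℚ-* n (suc n ∸ j) ⟨
      nℚ (n * (suc n ∸ j))            ≡⟨ cong (λ x → nℚ (x * (suc n ∸ j))) (ℕP.m+[n∸m]≡n j≤n) ⟨
      nℚ ((j + (n ∸ j)) * (suc n ∸ j)) ≡⟨ cong nℚ (ℕP.*-distribʳ-+ (suc n ∸ j) j (n ∸ j)) ⟩
      nℚ (j * (suc n ∸ j) + T)        ∎

  sift-below : ∀ (g : ℕ → ℚ) r → r < j → sumTo r (λ k → g k ℚ.* α k h) ≡ 0ℚ
  sift-below g zero    _     = refl
  sift-below g (suc r) 1+r<j = begin
    sumTo r (λ k → g k ℚ.* α k h) ℚ.+ g (suc r) ℚ.* α (suc r) h
      ≡⟨ cong₂ (λ a b → a ℚ.+ g (suc r) ℚ.* b) (sift-below g r (ℕP.<⇒≤ 1+r<j))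
           (trans (dual (suc r) (s≤s z≤n) (ℕP.≤-trans (ℕP.<⇒≤ 1+r<j) j≤n)) (δ-offdiag (ℕP.<⇒≢ 1+r<j))) ⟩
    0ℚ ℚ.+ g (suc r) ℚ.* 0ℚ
      ≡⟨ solve 1 (λ x → con 0ℚ :+ x :* con 0ℚ := con 0ℚ) refl (g (suc r)) ⟩
    0ℚ
      ∎
    where open ≡-Reasoning

  sift : ∀ (g : ℕ → ℚ) r → j ≤ r → r ≤ n → sumTo r (λ k → g k ℚ.* α k h) ≡ g j
  sift g zero    j≤0   _     = ⊥-elim (ℕP.<⇒≱ 1≤j j≤0)
  sift g (suc r) j≤1+r 1+r≤n = [ earlier , here ]′ (ℕP.m≤n⇒m<n∨m≡n j≤1+r)
    where
    α[1+r] : α (suc r) h ≡ δ (suc r) j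
    α[1+r] = dual (suc r) (s≤s z≤n) 1+r≤n
    earlier : j < suc r → sumTo (suc r) (λ k → g k ℚ.* α k h) ≡ g j
    earlier (s≤s j≤r) = trans
      (cong₂ (λ a b → a ℚ.+ g (suc r) ℚ.* b) (sift g r j≤r (ℕP.<⇒≤ 1+r≤n))
                                             (trans α[1+r] (δ-offdiag (ℕP.>⇒≢ (s≤s j≤r)))))
      (solve 2 (λ x y → x :+ y :* con 0ℚ := x) refl (g j) (g (suc r)))
    here : j ≡ suc r → sumTo (suc r) (λ k → g k ℚ.* α k h) ≡ g j
    here refl = trans
      (cong₂ (λ a b → a ℚ.+ g j ℚ.* b) (sift-below g r ℕP.≤-refl) (trans α[1+r] (δ-diag j)))
      (solve 1 (λ x → con 0ℚ :+ x :* con 1ℚ := x) refl (g j))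

  γ-coweight : γ n h ≡ ½ ℚ.* nℚ (j ⊓ (suc n ∸ j))
  γ-coweight = cong (½ ℚ.*_) (sift (λ k → nℚ (k ⊓ (suc n ∸ k))) n j≤n ℕP.≤-refl)

-- For n + 1 = 2m and 1 ≤ j ≤ n put a = min(j, n + 1 − j) and d = m − a, so that
-- {j, n + 1 − j} = {a, a + 2d}.  Then 2ρ(β̃_j) = twoρ-at a d and 2ψ(β̃_j) = twoψ-at a d,
-- the latter being a (2(a + 2d) − 1) written without subtraction (a = 0 does not occur).
twoρ-at : ℕ → ℕ → ℕ
twoρ-at a d = a * (a + (d + d))

twoψ-at : ℕ → ℕ → ℕ
twoψ-at zero    d = 0
twoψ-at (suc a) d = suc a * ((suc a + (d + d)) + (a + (d + d)))

twoψ-at-+ : ∀ {a} d → 1 ≤ a → twoψ-at a d + a ≡ 2 * twoρ-at a d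
twoψ-at-+ {suc a} d _ = identity a d
  where
  identity : ∀ a d → suc a * ((suc a + (d + d)) + (a + (d + d))) + suc a
                   ≡ 2 * (suc a * (suc a + (d + d)))
  identity = solve-∀

twoρ-at-positive : ∀ {a} d → 1 ≤ a → 1 ≤ twoρ-at a d
twoρ-at-positive {a} d 1≤a = ℕP.*-mono-≤ 1≤a (ℕP.≤-trans 1≤a (ℕP.m≤m+n a (d + d)))

twoψ-at-positive : ∀ {a} d → 1 ≤ a → 1 ≤ twoψ-at a d
twoψ-at-positive {suc a} d _ = s≤s z≤n

*-≤-⊓ : ∀ i a {F G} → (i ≤ a → F ≤ G) → (a ≤ i → i * F ≤ a * G) → i * F ≤ (i ⊓ a) * G
*-≤-⊓ i a i≤a⇒ a≤i⇒ with ℕP.≤-total i a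
... | inj₁ i≤a rewrite ℕP.m≤n⇒m⊓n≡m i≤a = ℕP.*-monoʳ-≤ i (i≤a⇒ i≤a)
... | inj₂ a≤i rewrite ℕP.m≥n⇒m⊓n≡n a≤i = a≤i⇒ a≤i

*-≤-half : ∀ {m} i X Y → i + i ≤ m → X ≤ Y + Y → i * X ≤ m * Y
*-≤-half {m} i X Y 2i≤m X≤2Y = begin
  i * X          ≤⟨ ℕP.*-monoʳ-≤ i X≤2Y ⟩
  i * (Y + Y)    ≡⟨ ℕP.*-distribˡ-+ i Y Y ⟩
  i * Y + i * Y  ≡⟨ ℕP.*-distribʳ-+ Y i i ⟨
  (i + i) * Y    ≤⟨ ℕP.*-monoˡ-≤ Y 2i≤m ⟩
  m * Y          ∎
  where open ℕP.≤-Reasoning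

twoρ-at-mono : ∀ a d → twoρ-at a d ≤ twoρ-at (a + d) 0
twoρ-at-mono a d = m+o≡n⇒m≤n (d * d) (expand a d)
  where
  expand : ∀ a d → a * (a + (d + d)) + d * d ≡ (a + d) * ((a + d) + (0 + 0))
  expand = solve-∀

twoψ-at-mono : ∀ a d → twoψ-at (suc a) d ≤ twoψ-at (suc a + d) 0
twoψ-at-mono a d = ℕP.+-cancelʳ-≤ d (twoψ-at (suc a) d) (twoψ-at (suc a + d) 0) (begin
  twoψ-at (suc a) d + d                ≤⟨ ℕP.+-monoʳ-≤ (twoψ-at (suc a) d) (d≤2d² d) ⟩
  twoψ-at (suc a) d + (d + d) * d      ≡⟨ expand a d ⟩
  twoψ-at (suc a + d) 0 + d            ∎)
  where
  open ℕP.≤-Reasoning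
  d≤2d² : ∀ d → d ≤ (d + d) * d
  d≤2d² zero    = z≤n
  d≤2d² (suc d) = ℕP.m≤n*m (suc d) (suc d + suc d)
  expand : ∀ a d → suc a * ((suc a + (d + d)) + (a + (d + d))) + (d + d) * d
                 ≡ suc (a + d) * ((suc (a + d) + (0 + 0)) + ((a + d) + (0 + 0))) + d
  expand = solve-∀

twoρ-at-ratio : ∀ i a d {m} → a + d ≡ m → i + i ≤ m → i * twoρ-at a d ≤ (i ⊓ a) * twoρ-at m 0
twoρ-at-ratio i a d refl 2i≤m = *-≤-⊓ i a (λ _ → twoρ-at-mono a d) λ _ → begin
  i * (a * (a + (d + d)))  ≡⟨ x∙yz≈y∙xz i a (a + (d + d)) ⟩
  a * (i * (a + (d + d)))  ≤⟨ ℕP.*-monoʳ-≤ a (*-≤-half i (a + (d + d)) (a + d + (0 + 0)) 2i≤m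
                                                 (m+o≡n⇒m≤n a (halves a d))) ⟩
  a * twoρ-at (a + d) 0    ∎
  where
  open ℕP.≤-Reasoning
  halves : ∀ a d → a + (d + d) + a ≡ (a + d + (0 + 0)) + (a + d + (0 + 0))
  halves = solve-∀

twoψ-at-ratio : ∀ i a d {m} → 1 ≤ a → a + d ≡ m → i + i ≤ m →
                i * twoψ-at a d ≤ (i ⊓ a) * twoψ-at m 0
twoψ-at-ratio i (suc a) d _ refl 2i≤m = *-≤-⊓ i (suc a) (λ _ → twoψ-at-mono a d) λ _ → begin
  i * (suc a * X)                ≡⟨ x∙yz≈y∙xz i (suc a) X ⟩
  suc a * (i * X)                ≤⟨ ℕP.*-monoʳ-≤ (suc a) (*-≤-half i X Y 2i≤m
                                                         (m+o≡n⇒m≤n (suc (a + a)) (halves a d))) ⟩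
  suc a * twoψ-at (suc a + d) 0  ∎
  where
  open ℕP.≤-Reasoning
  X = (suc a + (d + d)) + (a + (d + d))
  Y = (suc (a + d) + (0 + 0)) + ((a + d) + (0 + 0))
  halves : ∀ a d → (suc a + (d + d)) + (a + (d + d)) + suc (a + a)
                 ≡ ((suc (a + d) + (0 + 0)) + ((a + d) + (0 + 0)))
                 + ((suc (a + d) + (0 + 0)) + ((a + d) + (0 + 0)))
  halves = solve-∀

module Middle (n : ℕ) (β̃ : ℕ → Vect)
              (traceless : ∀ j → 1 ≤ j → j ≤ n → Traceless n (β̃ j))
              (dual : ∀ k j → 1 ≤ k → k ≤ n → 1 ≤ j → j ≤ n → α k (β̃ j) ≡ δ k j)
              (m i : ℕ) (halves : suc n ≡ m + m) (1≤i : 1 ≤ i) (2i≤m : i + i ≤ m) where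

  μ : Functional
  μ = λw i ⊕ λw (suc n ∸ i)

  2i≤1+n : i + i ≤ suc n
  2i≤1+n = ℕP.≤-trans 2i≤m (subst (m ≤_) (sym halves) (ℕP.m≤m+n m m))

  1≤m : 1 ≤ m
  1≤m = ℕP.≤-trans 1≤i (ℕP.m+n≤o⇒m≤o i 2i≤m)

  m≤n : m ≤ n
  m≤n = ℕ.s≤s⁻¹ (subst (suc m ≤_) (sym halves)
                  (subst (_≤ m + m) (ℕP.+-comm m 1) (ℕP.+-monoʳ-≤ m 1≤m)))

  module At (j : ℕ) (1≤j : 1 ≤ j) (j≤n : j ≤ n) where
    open Coweight n j 1≤j j≤n (β̃ j) (traceless j 1≤j j≤n) (λ k 1≤k k≤n → dual k j 1≤k k≤n 1≤j j≤n)

    a d : ℕ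
    a = j ⊓ (suc n ∸ j)
    d = m ∸ a

    a≤m : a ≤ m
    a≤m = subst (λ N → j ⊓ (N ∸ j) ≤ m) (sym halves) (⊓-∸-≤-half m j)

    1≤a : 1 ≤ a
    1≤a = ℕP.⊓-glb 1≤j (ℕP.m<n⇒0<n∸m (s≤s j≤n))

    a+d≡m : a + d ≡ m
    a+d≡m = ℕP.m+[n∸m]≡n a≤m

    μ-value : μ (β̃ j) ≡ nℚ (i ⊓ a)
    μ-value = μ-coweight i 2i≤1+n

    twoρ-value : twoρ n (β̃ j) ≡ nℚ (twoρ-at a d)
    twoρ-value = trans twoρ-coweight
      (cong nℚ (trans (*-∸-⊓ j (ℕP.m≤n⇒m≤1+n j≤n)) (cong (a *_) 1+n∸a)))
      where
      1+n∸a : suc n ∸ a ≡ a + (d + d)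
      1+n∸a = subst (λ N → N ∸ a ≡ a + (d + d)) (sym halves) (∸-around-half a≤m)

    ψ-value : ψ n (β̃ j) ≡ ½ ℚ.* nℚ (twoψ-at a d)
    ψ-value = trans (cong₂ ℚ._-_ twoρ-value γ-coweight)
                    (half-difference {twoψ-at a d} {a} {twoρ-at a d} (twoψ-at-+ d 1≤a))

  module Mid = At m 1≤m m≤n

  a-mid : Mid.a ≡ m
  a-mid = trans (cong (m ⊓_) (trans (cong (_∸ m) halves) (ℕP.m+n∸m≡n m m))) (ℕP.⊓-idem m)

  d-mid : Mid.d ≡ 0
  d-mid = trans (cong (m ∸_) a-mid) (ℕP.n∸n≡0 m)

  μ-mid : μ (β̃ m) ≡ nℚ i
  μ-mid = trans Mid.μ-value
    (cong nℚ (trans (cong (i ⊓_) a-mid) (ℕP.m≤n⇒m⊓n≡m (ℕP.m+n≤o⇒m≤o i 2i≤m))))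

  min-at-middle : (den : Functional) (κ : ℚ) .{{_ : ℚ.Positive κ}} (F : ℕ → ℕ → ℕ) →
                  (∀ {a} d → 1 ≤ a → 1 ≤ F a d) →
                  (∀ a d → 1 ≤ a → a + d ≡ m → i * F a d ≤ (i ⊓ a) * F m 0) →
                  (∀ j 1≤j j≤n → den (β̃ j) ≡ κ ℚ.* nℚ (F (At.a j 1≤j j≤n) (At.d j 1≤j j≤n))) →
                  InMinSet n β̃ den μ m
  min-at-middle den κ F F-positive ratio den-value =
    sym (minTo-attained n (λ j → div (μ (β̃ j)) (den (β̃ j))) m 1≤m m≤n middle-least)
    where
    den-mid : den (β̃ m) ≡ κ ℚ.* nℚ (F m 0)
    den-mid = trans (den-value m 1≤m m≤n) (cong (λ x → κ ℚ.* nℚ x) (cong₂ F a-mid d-mid))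
    middle-least : ∀ j → 1 ≤ j → j ≤ n → div (μ (β̃ m)) (den (β̃ m)) ℚ.≤ div (μ (β̃ j)) (den (β̃ j))
    middle-least j 1≤j j≤n =
      subst₂ ℚ._≤_ (cong₂ div (sym μ-mid) (sym den-mid))
                   (cong₂ div (sym J.μ-value) (sym (den-value j 1≤j j≤n)))
        (nℚ-ratio-≤ κ i (F m 0) (i ⊓ J.a) (F J.a J.d) (F-positive 0 1≤m) (F-positive J.d J.1≤a)
          (ratio J.a J.d J.1≤a J.a+d≡m))
      where module J = At j 1≤j j≤n

  in-I : InI n β̃ μ m
  in-I = min-at-middle (twoρ n) 1ℚ twoρ-at twoρ-at-positive
    (λ a d _ a+d≡m → twoρ-at-ratio i a d a+d≡m 2i≤m)
    (λ j 1≤j j≤n → trans (At.twoρ-value j 1≤j j≤n) (sym (ℚP.*-identityˡ _)))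

  in-I' : InI' n β̃ μ m
  in-I' = min-at-middle (ψ n) ½ twoψ-at twoψ-at-positive
    (λ a d 1≤a a+d≡m → twoψ-at-ratio i a d 1≤a a+d≡m 2i≤m)
    At.ψ-value

theorem10 : (n : ℕ) → 3 ≤ n → n % 2 ≡ 1 →
    (β̃ : ℕ → Vect) →
    (∀ j → 1 ≤ j → j ≤ n → Traceless n (β̃ j)) →
    (∀ i j → 1 ≤ i → i ≤ n → 1 ≤ j → j ≤ n → α i (β̃ j) ≡ δ i j) →
    (i : ℕ) → 1 ≤ i → i ≤ suc n / 4 →
    InI n β̃ (λw i ⊕ λw (suc n ∸ i)) (suc n / 2)
      × InI' n β̃ (λw i ⊕ λw (suc n ∸ i)) (suc n / 2)
theorem10 n _ n-odd β̃ traceless dual i 1≤i i≤[1+n]/4 = M.in-I , M.in-I'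
  where
  halves : suc n ≡ suc n / 2 + suc n / 2
  halves = odd-halves n-odd
  module M = Middle n β̃ traceless dual (suc n / 2) i halves 1≤i
                    (quarter-doubled-≤-half halves i≤[1+n]/4)
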